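{- Let $\mathcal{G}=(G_A\cup G_B,F)$ be a mixed graph in the two-player communication setting, and let $k$ be a parameter with $k\ge\nu(\mathcal{G})+1$. Let $P_A$ and $P_B$ be $k$-forest packings of $G_A$ and $G_B$ respectively, and let $\mathcal{P}=(P_A\cup P_B,F)$. Then: (1) both $P_A$ and $P_B$ have average degree $O(k)$; (2) $\nu(\mathcal{G})=\nu(\mathcal{P})$; (3) a cut $(S,T)$ is a minimum $s$-$t$ cut of $\mathcal{G}$ if and only if it is a minimum $s$-$t$ cut of $\mathcal{P}$.
   Context: Alice holds an undirected unweighted graph $G_A=(V,E_A)$, Bob holds $G_B=(V,E_B)$; $G_A\cup G_B=(V,E_A\cup E_B)$. A mixed graph $(G,F)$ consists of an undirected unweighted graph $G$ and a directed graph $F$ with positive integer weights on $V$, with terminals $s,t$; the value of a partition $(S,T)$ is $|E_G(S,T)|+w_F(S,T)$, where $w_F(S,T)$ is the total weight of edges of $F$ directed from $S$ to $T$; $\nu$ is the minimum value over $s$-$t$ cuts ($s\in S,t\in T$), attained by minimum $s$-$t$ cuts. A $k$-forest packing of an undirected graph $X$ is $F_1\cup\dots\cup F_k$ where each $F_i$ is a spanning forest of $X\setminus(F_1\cup\dots\cup F_{i-1})$. -}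

module Defs where

open import Data.Nat using (ℕ; zero; suc; _+_; _*_; _≤_; _<ᵇ_)
open import Data.Bool using (Bool; true; false; _∧_; _∨_; not; if_then_else_)
open import Data.Fin using (Fin; zero; suc; toℕ)
open import Data.List using (List; []; _∷_; length; _∷ʳ_)
open import Data.List.Relation.Unary.Linked using (Linked)
open import Data.List.Relation.Unary.Unique.Propositional using (Unique)
open import Data.Product using (Σ; _×_)
open import Relation.Binary.PropositionalEquality using (_≡_)
open import Relation.Nullary using (¬_)
open import Function using (_∘_)

-- Undirected unweighted graph on vertex set Fin n, given by its adjacency
-- (Boolean) matrix; simplicity (symmetric, loopless) is a separate predicate.
UGraph : ℕ → Set
UGraph n = Fin n → Fin n → Bool

-- Directed graph with positive integer weights: W u v = weight of edge u → v,
-- with W u v = 0 meaning "no edge".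
WDigraph : ℕ → Set
WDigraph n = Fin n → Fin n → ℕ

IsSimple : ∀ {n} → UGraph n → Set
IsSimple {n} G = (∀ (u v : Fin n) → G u v ≡ G v u) × (∀ (u : Fin n) → G u u ≡ false)

Adj : ∀ {n} → UGraph n → Fin n → Fin n → Set
Adj G u v = G u v ≡ true

_∪ᴳ_ : ∀ {n} → UGraph n → UGraph n → UGraph n
(G ∪ᴳ H) u v = G u v ∨ H u v

_∖ᴳ_ : ∀ {n} → UGraph n → UGraph n → UGraph n
(G ∖ᴳ H) u v = G u v ∧ not (H u v)

Subgraph : ∀ {n} → UGraph n → UGraph n → Set
Subgraph {n} H G = ∀ (u v : Fin n) → Adj H u v → Adj G u v

sumFin : ∀ {n} → (Fin n → ℕ) → ℕ
sumFin {zero} f = 0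
sumFin {suc n} f = f zero + sumFin (f ∘ suc)

anyFin : ∀ {n} → (Fin n → Bool) → Bool
anyFin {zero} f = false
anyFin {suc n} f = f zero ∨ anyFin (f ∘ suc)

data Reach {n} (G : UGraph n) : Fin n → Fin n → Set where
  here : ∀ {u} → Reach G u u
  step : ∀ {u v w} → Adj G u v → Reach G v w → Reach G u w

IsCycle : ∀ {n} → UGraph n → Fin n → List (Fin n) → Set
IsCycle G x xs = (2 ≤ length xs) × Unique (x ∷ xs) × Linked (Adj G) ((x ∷ xs) ∷ʳ x)

Acyclic : ∀ {n} → UGraph n → Set
Acyclic {n} G = ∀ (x : Fin n) (xs : List (Fin n)) → ¬ IsCycle G x xs

IsSpanningForest : ∀ {n} → UGraph n → UGraph n → Set
IsSpanningForest {n} X H =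
  IsSimple H × Subgraph H X × Acyclic H ×
  (∀ (u v : Fin n) → Reach X u v → Reach H u v)

unionBefore : ∀ {n k} → (Fin k → UGraph n) → Fin k → UGraph n
unionBefore Fs i u v = anyFin (λ j → (toℕ j <ᵇ toℕ i) ∧ Fs j u v)

bigUnion : ∀ {n k} → (Fin k → UGraph n) → UGraph n
bigUnion Fs u v = anyFin (λ j → Fs j u v)

-- (F_1,...,F_k) is a k-forest packing sequence of X: each F_i is a spanning
-- forest of X ∖ (F_1 ∪ ... ∪ F_{i-1}); the packing itself is bigUnion Fs.
IsForestPacking : ∀ {n} (k : ℕ) → UGraph n → (Fin k → UGraph n) → Set
IsForestPacking k X Fs = ∀ (i : Fin k) → IsSpanningForest (X ∖ᴳ unionBefore Fs i) (Fs i)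

sumDeg : ∀ {n} → UGraph n → ℕ
sumDeg G = sumFin (λ u → sumFin (λ v → if G u v then 1 else 0))

-- cut given by S : Fin n → Bool (true = side S, false = side T)
cutG : ∀ {n} → UGraph n → (Fin n → Bool) → ℕ
cutG G S = sumFin (λ u → sumFin (λ v → if S u ∧ not (S v) ∧ G u v then 1 else 0))

cutF : ∀ {n} → WDigraph n → (Fin n → Bool) → ℕ
cutF F S = sumFin (λ u → sumFin (λ v → if S u ∧ not (S v) then F u v else 0))

cutValue : ∀ {n} → UGraph n → WDigraph n → (Fin n → Bool) → ℕ
cutValue G F S = cutG G S + cutF F S

IsSTCut : ∀ {n} → Fin n → Fin n → (Fin n → Bool) → Set
IsSTCut s t S = (S s ≡ true) × (S t ≡ false)

IsMinCut : ∀ {n} → UGraph n → WDigraph n → Fin n → Fin n → (Fin n → Bool) → Set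
IsMinCut G F s t S =
  IsSTCut s t S × (∀ S′ → IsSTCut s t S′ → cutValue G F S ≤ cutValue G F S′)

IsMinCutValue : ∀ {n} → UGraph n → WDigraph n → Fin n → Fin n → ℕ → Set
IsMinCutValue G F s t v = Σ _ (λ S → IsMinCut G F s t S × cutValue G F S ≡ v)

{-# OPTIONS --safe #-}
module Submission where

-- A simple acyclic graph on n vertices has at most n edges: deleting the edge at a leaf (the end
-- of a path that cannot be extended without closing a cycle) lowers the degree sum by 2 and
-- isolates the leaf. So a k-forest packing has degree sum at most 2kn.
--
-- Let G = G_A ∪ G_B and P = P_A ∪ P_B ⊆ G. If every edge of G crossing a cut lies in P, the cut
-- has the same value in both. Otherwise a crossing edge uv of, say, G_A is missing from P_A, so uv
-- was available to every forest F_i of the packing; u and v are then connected in F_i, which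
-- therefore has a crossing edge, and as the F_i are edge-disjoint the cut has value at least
-- k > ν(G) in P. Cuts of value below k thus agree in G and P, which forces the minimum cuts and
-- their values to coincide.

open import Defs
open import Data.Bool using (Bool; true; false; _∧_; _∨_; not; if_then_else_)
open import Data.Bool.Properties
  using (∧-comm; ∧-conicalˡ; ∧-conicalʳ; ∧-zeroʳ; ∨-comm; ∨-conicalˡ; ∨-conicalʳ; ∨-zeroʳ) renaming (_≟_ to _≟ᵇ_)
open import Data.Empty using (⊥-elim)
open import Data.Fin using (Fin; zero; suc; toℕ; _≟_)
open import Data.Fin.Properties as Finₚ using (any?; pigeonhole; toℕ-injective)
open import Data.List using (List; []; _∷_; length; _∷ʳ_; lookup)
open import Data.List.Membership.Propositional using (_∈_)
open import Data.List.Membership.Propositional.Properties using (∈-lookup)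
open import Data.List.Relation.Unary.All as All using (All; []; _∷_)
open import Data.List.Relation.Unary.All.Properties using (¬Any⇒All¬)
open import Data.List.Relation.Unary.AllPairs using ([]; _∷_)
open import Data.List.Relation.Unary.Any as Any using (here; there)
open import Data.List.Relation.Unary.Linked as Linked using (Linked; []; [-]; _∷_)
open import Data.List.Relation.Unary.Unique.Propositional using (Unique)
open import Data.Nat using (ℕ; zero; suc; _+_; _*_; _≤_; _<_; z≤n; s≤s; _<ᵇ_)
open import Data.Nat.Induction using (<-wellFounded)
open import Data.Nat.Properties hiding (_≟_)
open import Algebra.Properties.CommutativeMonoid.Sum +-0-commutativeMonoid using (sum; ∑-distrib-+; ∑-comm)
open import Data.Product using (Σ; _×_; _,_; proj₁; proj₂; ∃; ∃₂)
open import Data.Sum using (_⊎_; inj₁; inj₂; [_,_]′)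
open import Data.Vec.Functional using () renaming (_∷_ to _◃_)
open import Function using (_∘_; _on_; id)
open import Function.Bundles using (_⇔_; mk⇔)
open import Induction.WellFounded using (Acc; acc)
open import Relation.Binary.Construct.On using (wellFounded)
open import Relation.Binary.Definitions using (tri<; tri≈; tri>)
open import Relation.Binary.PropositionalEquality
  using (_≡_; _≢_; _≗_; refl; sym; trans; cong; cong₂; module ≡-Reasoning)
open import Relation.Nullary using (yes; no; does)
open import Relation.Nullary.Decidable using (_×-dec_; ¬?; dec-true; dec-false)

-- Finite sums

⟦_⟧ : Bool → ℕ
⟦ b ⟧ = if b then 1 else 0

⟦⟧≤1 : ∀ b → ⟦ b ⟧ ≤ 1
⟦⟧≤1 false = z≤n
⟦⟧≤1 true = ≤-refl

⟦⟧-mono : ∀ {a b} → (a ≡ true → b ≡ true) → ⟦ a ⟧ ≤ ⟦ b ⟧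
⟦⟧-mono {false} _ = z≤n
⟦⟧-mono {true} a⇒b rewrite a⇒b refl = ≤-refl

⟦∨⟧≤ : ∀ a b → ⟦ a ∨ b ⟧ ≤ ⟦ a ⟧ + ⟦ b ⟧
⟦∨⟧≤ false b = ≤-refl
⟦∨⟧≤ true b = s≤s z≤n

⟦⟧≤⟦∧not⟧+ : ∀ a b → ⟦ a ⟧ ≤ ⟦ a ∧ not b ⟧ + ⟦ b ⟧
⟦⟧≤⟦∧not⟧+ false b = z≤n
⟦⟧≤⟦∧not⟧+ true false = ≤-refl
⟦⟧≤⟦∧not⟧+ true true = ≤-refl

∨-true : ∀ a {b} → a ∨ b ≡ true → a ≡ true ⊎ b ≡ true
∨-true true _ = inj₁ refl
∨-true false b≡true = inj₂ b≡true

sumFin≡sum : ∀ {n} (f : Fin n → ℕ) → sumFin f ≡ sum f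
sumFin≡sum {zero} f = refl
sumFin≡sum {suc n} f = cong (f zero +_) (sumFin≡sum (f ∘ suc))

sumFin-cong : ∀ {n} {f g : Fin n → ℕ} → f ≗ g → sumFin f ≡ sumFin g
sumFin-cong {zero} f≗g = refl
sumFin-cong {suc n} f≗g = cong₂ _+_ (f≗g zero) (sumFin-cong (f≗g ∘ suc))

sumFin-mono : ∀ {n} {f g : Fin n → ℕ} → (∀ i → f i ≤ g i) → sumFin f ≤ sumFin g
sumFin-mono {zero} f≤g = z≤n
sumFin-mono {suc n} f≤g = +-mono-≤ (f≤g zero) (sumFin-mono (f≤g ∘ suc))

sumFin-zero : ∀ {n} {f : Fin n → ℕ} → (∀ i → f i ≡ 0) → sumFin f ≡ 0
sumFin-zero {zero} f≡0 = refl
sumFin-zero {suc n} f≡0 = cong₂ _+_ (f≡0 zero) (sumFin-zero (f≡0 ∘ suc))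

sumFin-single : ∀ {n} {f : Fin n → ℕ} (a : Fin n) → (∀ i → i ≢ a → f i ≡ 0) → sumFin f ≡ f a
sumFin-single {suc n} {f} zero f≡0 =
  trans (cong (f zero +_) (sumFin-zero (λ i → f≡0 (suc i) λ ()))) (+-identityʳ (f zero))
sumFin-single {suc n} (suc a) f≡0 =
  cong₂ _+_ (f≡0 zero λ ()) (sumFin-single a (λ i i≢a → f≡0 (suc i) (i≢a ∘ Finₚ.suc-injective)))

≤-sumFin : ∀ {n} {f : Fin n → ℕ} (a : Fin n) → f a ≤ sumFin f
≤-sumFin {suc n} {f} zero = m≤m+n (f zero) _
≤-sumFin {suc n} {f} (suc a) = ≤-trans (≤-sumFin a) (m≤n+m _ (f zero))

sumFin-< : ∀ {n} {f g : Fin n → ℕ} (a : Fin n) → (∀ i → f i ≤ g i) → f a < g a → sumFin f < sumFin g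
sumFin-< {suc n} zero f≤g fa<ga = +-mono-<-≤ fa<ga (sumFin-mono (f≤g ∘ suc))
sumFin-< {suc n} (suc a) f≤g fa<ga = +-mono-≤-< (f≤g zero) (sumFin-< a (f≤g ∘ suc) fa<ga)

sumFin-≤-* : ∀ {n} {f : Fin n → ℕ} (c : ℕ) → (∀ i → f i ≤ c) → sumFin f ≤ n * c
sumFin-≤-* {zero} c f≤c = z≤n
sumFin-≤-* {suc n} c f≤c = +-mono-≤ (f≤c zero) (sumFin-≤-* c (f≤c ∘ suc))

*-≤-sumFin : ∀ {n} {f : Fin n → ℕ} (c : ℕ) → (∀ i → c ≤ f i) → n * c ≤ sumFin f
*-≤-sumFin {zero} c c≤f = z≤n
*-≤-sumFin {suc n} c c≤f = +-mono-≤ (c≤f zero) (*-≤-sumFin c (c≤f ∘ suc))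

sumFin-distrib-+ : ∀ {n} (f g : Fin n → ℕ) → sumFin (λ i → f i + g i) ≡ sumFin f + sumFin g
sumFin-distrib-+ f g = begin
  sumFin (λ i → f i + g i) ≡⟨ sumFin≡sum (λ i → f i + g i) ⟩
  sum (λ i → f i + g i)    ≡⟨ ∑-distrib-+ f g ⟩
  sum f + sum g            ≡⟨ cong₂ _+_ (sumFin≡sum f) (sumFin≡sum g) ⟨
  sumFin f + sumFin g      ∎
  where open ≡-Reasoning

sumFin₂-distrib-+ : ∀ {n} (f g : Fin n → Fin n → ℕ) →
  sumFin (λ u → sumFin (λ v → f u v + g u v)) ≡ sumFin (λ u → sumFin (f u)) + sumFin (λ u → sumFin (g u))
sumFin₂-distrib-+ f g = trans (sumFin-cong (λ u → sumFin-distrib-+ (f u) (g u)))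
  (sumFin-distrib-+ (λ u → sumFin (f u)) (λ u → sumFin (g u)))

sumFin-comm : ∀ {m n} (f : Fin m → Fin n → ℕ) →
  sumFin (λ i → sumFin (λ j → f i j)) ≡ sumFin (λ j → sumFin (λ i → f i j))
sumFin-comm f = begin
  sumFin (λ i → sumFin (λ j → f i j)) ≡⟨ sumFin-cong (λ i → sumFin≡sum (f i)) ⟩
  sumFin (λ i → sum (λ j → f i j))    ≡⟨ sumFin≡sum (λ i → sum (f i)) ⟩
  sum (λ i → sum (λ j → f i j))       ≡⟨ ∑-comm f ⟩
  sum (λ j → sum (λ i → f i j))       ≡⟨ sumFin≡sum (λ j → sum (λ i → f i j)) ⟨
  sumFin (λ j → sum (λ i → f i j))    ≡⟨ sumFin-cong (λ j → sumFin≡sum (λ i → f i j)) ⟨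
  sumFin (λ j → sumFin (λ i → f i j)) ∎
  where open ≡-Reasoning

sumFin-comm₃ : ∀ {m n k} (f : Fin m → Fin n → Fin k → ℕ) →
  sumFin (λ u → sumFin (λ v → sumFin (λ i → f u v i))) ≡
  sumFin (λ i → sumFin (λ u → sumFin (λ v → f u v i)))
sumFin-comm₃ f =
  trans (sumFin-cong (λ u → sumFin-comm (f u))) (sumFin-comm (λ u i → sumFin (λ v → f u v i)))

anyFin⇒∃ : ∀ {n} (f : Fin n → Bool) → anyFin f ≡ true → ∃ λ i → f i ≡ true
anyFin⇒∃ {zero} f ()
anyFin⇒∃ {suc n} f some with f zero in f0
... | true = zero , f0
... | false = let i , fi = anyFin⇒∃ (f ∘ suc) some in suc i , fi

∃⇒anyFin : ∀ {n} {f : Fin n → Bool} (i : Fin n) → f i ≡ true → anyFin f ≡ true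
∃⇒anyFin zero fi rewrite fi = refl
∃⇒anyFin {f = f} (suc i) fi = trans (cong (f zero ∨_) (∃⇒anyFin i fi)) (∨-zeroʳ (f zero))

anyFin≡false⇒ : ∀ {n} {f : Fin n → Bool} → anyFin f ≡ false → ∀ i → f i ≡ false
anyFin≡false⇒ {f = f} none i with f i in fi
... | false = refl
... | true with () ← trans (sym none) (∃⇒anyFin i fi)

all-false⇒anyFin≡false : ∀ {n} {f : Fin n → Bool} → (∀ i → f i ≡ false) → anyFin f ≡ false
all-false⇒anyFin≡false {zero} none = refl
all-false⇒anyFin≡false {suc n} none = cong₂ _∨_ (none zero) (all-false⇒anyFin≡false (none ∘ suc))

⟦anyFin⟧≤sumFin : ∀ {n} (f : Fin n → Bool) → ⟦ anyFin f ⟧ ≤ sumFin (⟦_⟧ ∘ f)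
⟦anyFin⟧≤sumFin {zero} f = z≤n
⟦anyFin⟧≤sumFin {suc n} f =
  ≤-trans (⟦∨⟧≤ (f zero) _) (+-monoʳ-≤ ⟦ f zero ⟧ (⟦anyFin⟧≤sumFin (f ∘ suc)))

sumFin≤⟦anyFin⟧ : ∀ {n} (f : Fin n → Bool) → (∀ {i j} → f i ≡ true → f j ≡ true → i ≡ j) →
  sumFin (⟦_⟧ ∘ f) ≤ ⟦ anyFin f ⟧
sumFin≤⟦anyFin⟧ {zero} f _ = z≤n
sumFin≤⟦anyFin⟧ {suc n} f atMostOne with f zero in f0
... | true = ≤-reflexive (cong suc (sumFin-zero others))
  where
  others : ∀ i → ⟦ f (suc i) ⟧ ≡ 0
  others i with f (suc i) in fi
  ... | false = refl
  ... | true with () ← atMostOne f0 fi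
... | false = sumFin≤⟦anyFin⟧ (f ∘ suc) (λ fi fj → Finₚ.suc-injective (atMostOne fi fj))

-- Degree sums and cuts

∪ᴳ-⊆ˡ : ∀ {n} (G H : UGraph n) → Subgraph G (G ∪ᴳ H)
∪ᴳ-⊆ˡ G H u v uv = cong (_∨ H u v) uv

∪ᴳ-⊆ʳ : ∀ {n} (G H : UGraph n) → Subgraph H (G ∪ᴳ H)
∪ᴳ-⊆ʳ G H u v uv = trans (cong (G u v ∨_) uv) (∨-zeroʳ (G u v))

∖ᴳ-⊆ : ∀ {n} (G H : UGraph n) → Subgraph (G ∖ᴳ H) G
∖ᴳ-⊆ G H u v = ∧-conicalˡ (G u v) _

sumDeg-∪ᴳ : ∀ {n} (G H : UGraph n) → sumDeg (G ∪ᴳ H) ≤ sumDeg G + sumDeg H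
sumDeg-∪ᴳ G H = ≤-trans (sumFin-mono λ u → sumFin-mono λ v → ⟦∨⟧≤ (G u v) (H u v))
  (≤-reflexive (sumFin₂-distrib-+ (λ u v → ⟦ G u v ⟧) (λ u v → ⟦ H u v ⟧)))

sumDeg-∖ᴳ : ∀ {n} (G H : UGraph n) → sumDeg G ≤ sumDeg (G ∖ᴳ H) + sumDeg H
sumDeg-∖ᴳ G H = ≤-trans (sumFin-mono λ u → sumFin-mono λ v → ⟦⟧≤⟦∧not⟧+ (G u v) (H u v))
  (≤-reflexive (sumFin₂-distrib-+ (λ u v → ⟦ (G ∖ᴳ H) u v ⟧) (λ u v → ⟦ H u v ⟧)))

sumDeg-bigUnion : ∀ {n k} (Fs : Fin k → UGraph n) → sumDeg (bigUnion Fs) ≤ sumFin (λ i → sumDeg (Fs i))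
sumDeg-bigUnion Fs = ≤-trans
  (sumFin-mono λ u → sumFin-mono λ v → ⟦anyFin⟧≤sumFin (λ i → Fs i u v))
  (≤-reflexive (sumFin-comm₃ (λ u v i → ⟦ Fs i u v ⟧)))

arc : ∀ {n} → Fin n → Fin n → UGraph n
arc x y u v = does (u ≟ x) ∧ does (v ≟ y)

edge : ∀ {n} → Fin n → Fin n → UGraph n
edge x y = arc x y ∪ᴳ arc y x

edge-symmetric : ∀ {n} (x y : Fin n) → ∀ u v → edge x y u v ≡ edge x y v u
edge-symmetric x y u v =
  trans (∨-comm (arc x y u v) _) (cong₂ _∨_ (∧-comm (does (u ≟ y)) _) (∧-comm (does (u ≟ x)) _))

arc-endpoints : ∀ {n} (x y : Fin n) → arc x y x y ≡ true
arc-endpoints x y rewrite dec-true (x ≟ x) refl | dec-true (y ≟ y) refl = refl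

edge-endpoints : ∀ {n} (x y : Fin n) → edge x y x y ≡ true
edge-endpoints x y = cong (_∨ arc y x x y) (arc-endpoints x y)

sumDeg-arc : ∀ {n} (x y : Fin n) → sumDeg (arc x y) ≡ 1
sumDeg-arc {n} x y = begin
  sumDeg (arc x y)               ≡⟨ sumFin-single x other-rows ⟩
  sumFin (λ v → ⟦ arc x y x v ⟧) ≡⟨ sumFin-single y other-columns ⟩
  ⟦ arc x y x y ⟧                ≡⟨ cong ⟦_⟧ (arc-endpoints x y) ⟩
  1                              ∎
  where
  open ≡-Reasoning
  other-rows : ∀ u → u ≢ x → sumFin (λ v → ⟦ arc x y u v ⟧) ≡ 0
  other-rows u u≢x rewrite dec-false (u ≟ x) u≢x = sumFin-zero {n} (λ _ → refl)
  other-columns : ∀ v → v ≢ y → ⟦ arc x y x v ⟧ ≡ 0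
  other-columns v v≢y rewrite dec-false (v ≟ y) v≢y = cong ⟦_⟧ (∧-zeroʳ (does (x ≟ x)))

sumDeg-edge : ∀ {n} (x y : Fin n) → sumDeg (edge x y) ≤ 2
sumDeg-edge x y = ≤-trans (sumDeg-∪ᴳ (arc x y) (arc y x))
  (≤-reflexive (cong₂ _+_ (sumDeg-arc x y) (sumDeg-arc y x)))

reach⇒crossing-edge : ∀ {n} {H : UGraph n} {S : Fin n → Bool} {u v} →
  Reach H u v → S u ≡ true → S v ≡ false → ∃₂ λ a b → S a ≡ true × S b ≡ false × Adj H a b
reach⇒crossing-edge here Su Sv with () ← trans (sym Su) Sv
reach⇒crossing-edge {S = S} (step {v = w} uw wv) Su Sv with S w in Sw
... | true = reach⇒crossing-edge wv Sw Sv
... | false = _ , w , Su , Sw , uw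

crossing-edge⇒1≤cutG : ∀ {n} {H : UGraph n} {S : Fin n → Bool} {a b} →
  S a ≡ true → S b ≡ false → Adj H a b → 1 ≤ cutG H S
crossing-edge⇒1≤cutG {H = H} {S} {a} {b} Sa Sb ab =
  ≤-trans (≤-reflexive (sym crossing)) (≤-trans (≤-sumFin b) (≤-sumFin a))
  where
  crossing : ⟦ S a ∧ not (S b) ∧ H a b ⟧ ≡ 1
  crossing rewrite Sa | Sb | ab = refl

cutG-mono : ∀ {n} {G H : UGraph n} (S : Fin n → Bool) →
  (∀ {u v} → S u ≡ true → S v ≡ false → Adj G u v → Adj H u v) → cutG G S ≤ cutG H S
cutG-mono {G = G} {H} S kept = sumFin-mono λ u → sumFin-mono λ v → ⟦⟧-mono (kept′ u v)
  where
  kept′ : ∀ u v → S u ∧ not (S v) ∧ G u v ≡ true → S u ∧ not (S v) ∧ H u v ≡ true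
  kept′ u v crosses with S u in Su | S v in Sv
  kept′ u v crosses | true | false = kept Su Sv crosses
  kept′ u v () | true | true
  kept′ u v () | false | _

cutG-mono-⊆ : ∀ {n} {G H : UGraph n} (S : Fin n → Bool) → Subgraph G H → cutG G S ≤ cutG H S
cutG-mono-⊆ S G⊆H = cutG-mono S λ {u} {v} _ _ → G⊆H u v

cutG-bigUnion : ∀ {n k} (Fs : Fin k → UGraph n) (S : Fin n → Bool) →
  (∀ {u v i j} → Adj (Fs i) u v → Adj (Fs j) u v → i ≡ j) →
  sumFin (λ i → cutG (Fs i) S) ≤ cutG (bigUnion Fs) S
cutG-bigUnion {k = k} Fs S disjoint = ≤-trans
  (≤-reflexive (sym (sumFin-comm₃ (λ u v i → ⟦ S u ∧ not (S v) ∧ Fs i u v ⟧))))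
  (sumFin-mono λ u → sumFin-mono λ v → crossing u v)
  where
  crossing : ∀ u v →
    sumFin (λ i → ⟦ S u ∧ not (S v) ∧ Fs i u v ⟧) ≤ ⟦ S u ∧ not (S v) ∧ bigUnion Fs u v ⟧
  crossing u v with S u | S v
  ... | true | false = sumFin≤⟦anyFin⟧ (λ i → Fs i u v) disjoint
  ... | true | true = ≤-reflexive (sumFin-zero {k} (λ _ → refl))
  ... | false | _ = ≤-reflexive (sumFin-zero {k} (λ _ → refl))

-- Forests

Adj-sym : ∀ {n} {H : UGraph n} → IsSimple H → ∀ {u v} → Adj H u v → Adj H v u
Adj-sym (symmetric , _) {u} {v} uv = trans (symmetric v u) uv

Acyclic-⊆ : ∀ {n} {H K : UGraph n} → Subgraph K H → Acyclic H → Acyclic K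
Acyclic-⊆ K⊆H acyclic x xs (long , unique , linked) =
  acyclic x xs (long , unique , Linked.map (λ {a} {b} → K⊆H a b) linked)

∖ᴳ-simple : ∀ {n} {G H : UGraph n} → IsSimple G → (∀ u v → H u v ≡ H v u) → IsSimple (G ∖ᴳ H)
∖ᴳ-simple {H = H} (symmetric , loopless) H-symmetric =
  (λ u v → cong₂ (λ g h → g ∧ not h) (symmetric u v) (H-symmetric u v)) ,
  (λ u → cong (_∧ not (H u u)) (loopless u))

lookup-distinct : ∀ {A : Set} {xs : List A} → Unique xs →
  ∀ {i j} → toℕ i < toℕ j → lookup xs i ≢ lookup xs j
lookup-distinct (x∉xs ∷ _) {zero} {suc j} _ = All.lookup x∉xs (∈-lookup j)
lookup-distinct (_ ∷ unique) {suc i} {suc j} (s≤s i<j) = lookup-distinct unique i<j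

Unique⇒length≤ : ∀ {n} {xs : List (Fin n)} → Unique xs → length xs ≤ n
Unique⇒length≤ {n} {xs} unique with length xs ≤? n
... | yes fits = fits
... | no too-long with i , j , i<j , same ← pigeonhole (≰⇒> too-long) (lookup xs) =
  ⊥-elim (lookup-distinct unique i<j same)

takeThrough : ∀ {A : Set} {z : A} {xs : List A} → z ∈ xs → List A
takeThrough {xs = x ∷ _} (here _) = x ∷ []
takeThrough {xs = x ∷ _} (there z∈xs) = x ∷ takeThrough z∈xs

takeThrough-nonEmpty : ∀ {A : Set} {z : A} {xs : List A} (z∈xs : z ∈ xs) → 1 ≤ length (takeThrough z∈xs)
takeThrough-nonEmpty (here _) = s≤s z≤n
takeThrough-nonEmpty (there _) = s≤s z≤n

All-takeThrough : ∀ {A : Set} {P : A → Set} {z : A} {xs : List A} (z∈xs : z ∈ xs) → All P xs → All P (takeThrough z∈xs)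
All-takeThrough (here _) (px ∷ _) = px ∷ []
All-takeThrough (there z∈xs) (px ∷ pxs) = px ∷ All-takeThrough z∈xs pxs

Unique-takeThrough : ∀ {A : Set} {z : A} {xs : List A} (z∈xs : z ∈ xs) → Unique xs → Unique (takeThrough z∈xs)
Unique-takeThrough (here _) (_ ∷ _) = [] ∷ []
Unique-takeThrough (there z∈xs) (x∉xs ∷ unique) = All-takeThrough z∈xs x∉xs ∷ Unique-takeThrough z∈xs unique

Linked-takeThrough : ∀ {A : Set} {R : A → A → Set} {z a b : A} {xs : List A} (z∈xs : z ∈ xs) →
  Linked R (a ∷ xs) → R z b → Linked R (a ∷ takeThrough z∈xs ∷ʳ b)
Linked-takeThrough (here refl) (r ∷ _) zb = r ∷ zb ∷ [-]
Linked-takeThrough (there z∈xs) (r ∷ linked) zb = r ∷ Linked-takeThrough z∈xs linked zb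

IsLeaf : ∀ {n} → UGraph n → Fin n → Fin n → Set
IsLeaf {n} H x y = Adj H x y × (∀ (v : Fin n) → Adj H x v → v ≡ y)

module LeafSearch {n} {H : UGraph n} (simple : IsSimple H) (acyclic : Acyclic H) where

  chord⇒cycle : ∀ {x y z rest} → Linked (Adj H) (x ∷ y ∷ rest) → Unique (x ∷ y ∷ rest) →
    (z∈rest : z ∈ rest) → Adj H z x → IsCycle H x (y ∷ takeThrough z∈rest)
  chord⇒cycle linked (x∉ ∷ unique) z∈rest zx =
    s≤s (takeThrough-nonEmpty z∈rest) ,
    (All-takeThrough (there z∈rest) x∉ ∷ Unique-takeThrough (there z∈rest) unique) ,
    Linked-takeThrough (there z∈rest) linked zx

  -- x ∷ y ∷ rest is a path grown at x; since a path has at most n vertices, n ≤ fuel + length rest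
  -- guarantees that the fuel outlasts the growth.
  grow : ∀ fuel x y rest → n ≤ fuel + length rest →
    Linked (Adj H) (x ∷ y ∷ rest) → Unique (x ∷ y ∷ rest) → ∃₂ (IsLeaf H)
  grow zero x y rest n≤ _ unique = ⊥-elim (<⇒≱ (≤-trans (n≤1+n _) (Unique⇒length≤ unique)) n≤)
  grow (suc fuel) x y rest n≤ linked@(xy ∷ _) unique with any? (λ z → (H x z ≟ᵇ true) ×-dec ¬? (z ≟ y))
  ... | no no-other = x , y , xy , only-y
    where
    only-y : ∀ v → Adj H x v → v ≡ y
    only-y v xv with v ≟ y
    ... | yes v≡y = v≡y
    ... | no v≢y = ⊥-elim (no-other (v , xv , v≢y))
  ... | yes (z , xz , z≢y) with Any.any? (z ≟_) rest
  ...   | yes z∈rest = ⊥-elim (acyclic x _ (chord⇒cycle linked unique z∈rest (Adj-sym simple xz)))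
  ...   | no z∉rest =
    grow fuel z x (y ∷ rest) (≤-trans n≤ (≤-reflexive (sym (+-suc fuel _))))
      (Adj-sym simple xz ∷ linked) (z∉ ∷ unique)
    where
    z≢x : z ≢ x
    z≢x refl with () ← trans (sym xz) (proj₂ simple x)
    z∉ : All (z ≢_) (x ∷ y ∷ rest)
    z∉ = z≢x ∷ z≢y ∷ ¬Any⇒All¬ rest z∉rest

  leaf-exists : ∀ {u v} → Adj H u v → ∃₂ (IsLeaf H)
  leaf-exists {u} {v} uv =
    grow n u v [] (≤-reflexive (sym (+-identityʳ n))) (uv ∷ [-]) ((u≢v ∷ []) ∷ [] ∷ [])
    where
    u≢v : u ≢ v
    u≢v refl with () ← trans (sym uv) (proj₂ simple u)

open LeafSearch using (leaf-exists)

leaf-isolated : ∀ {n} {H : UGraph n} {x y} → IsLeaf H x y → ∀ v → (H ∖ᴳ edge x y) x v ≡ false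
leaf-isolated {H = H} {x} {y} (_ , only-y) v with H x v in xv
... | false = refl
... | true rewrite only-y v xv | edge-endpoints x y = refl

nonIsolated : ∀ {n} → UGraph n → ℕ
nonIsolated H = sumFin (λ u → ⟦ anyFin (H u) ⟧)

nonIsolated-< : ∀ {n} {H K : UGraph n} {x y} → Subgraph K H → Adj H x y → (∀ v → K x v ≡ false) →
  nonIsolated K < nonIsolated H
nonIsolated-< {H = H} {K} {x} {y} K⊆H xy isolated = sumFin-< x
  (λ u → ⟦⟧-mono λ some → let v , uv = anyFin⇒∃ (K u) some in ∃⇒anyFin v (K⊆H u v uv))
  x-isolated
  where
  x-isolated : ⟦ anyFin (K x) ⟧ < ⟦ anyFin (H x) ⟧
  x-isolated rewrite all-false⇒anyFin≡false isolated | ∃⇒anyFin {f = H x} y xy = ≤-refl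

sumDeg≤2*nonIsolated : ∀ {n} (H : UGraph n) → Acc (_<_ on nonIsolated) H → IsSimple H → Acyclic H →
  sumDeg H ≤ 2 * nonIsolated H
sumDeg≤2*nonIsolated H (acc smaller) simple acyclic with any? (λ u → any? (λ v → H u v ≟ᵇ true))
... | no edgeless = ≤-trans (≤-reflexive (sumFin-zero λ u → sumFin-zero λ v → no-edge u v)) z≤n
  where
  no-edge : ∀ u v → ⟦ H u v ⟧ ≡ 0
  no-edge u v with H u v in uv
  ... | false = refl
  ... | true = ⊥-elim (edgeless (u , v , uv))
... | yes (u , v , uv) with x , y , leaf ← leaf-exists simple acyclic uv = begin
  sumDeg H                      ≤⟨ sumDeg-∖ᴳ H (edge x y) ⟩
  sumDeg H′ + sumDeg (edge x y) ≤⟨ +-mono-≤ (sumDeg≤2*nonIsolated H′ (smaller fewer) simple′ acyclic′)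
                                            (sumDeg-edge x y) ⟩
  2 * nonIsolated H′ + 2        ≡⟨ +-comm (2 * nonIsolated H′) 2 ⟩
  2 + 2 * nonIsolated H′        ≡⟨ *-suc 2 (nonIsolated H′) ⟨
  2 * suc (nonIsolated H′)      ≤⟨ *-monoʳ-≤ 2 fewer ⟩
  2 * nonIsolated H             ∎
  where
  open ≤-Reasoning
  H′ = H ∖ᴳ edge x y
  fewer : nonIsolated H′ < nonIsolated H
  fewer = nonIsolated-< (∖ᴳ-⊆ H (edge x y)) (proj₁ leaf) (leaf-isolated {H = H} leaf)
  simple′ : IsSimple H′
  simple′ = ∖ᴳ-simple simple (edge-symmetric x y)
  acyclic′ : Acyclic H′
  acyclic′ = Acyclic-⊆ (∖ᴳ-⊆ H (edge x y)) acyclic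

forest-sumDeg≤ : ∀ {n} {H : UGraph n} → IsSimple H → Acyclic H → sumDeg H ≤ 2 * n
forest-sumDeg≤ {n} {H} simple acyclic = begin
  sumDeg H          ≤⟨ sumDeg≤2*nonIsolated H (wellFounded nonIsolated <-wellFounded H) simple acyclic ⟩
  2 * nonIsolated H ≤⟨ *-monoʳ-≤ 2 (sumFin-≤-* 1 (λ u → ⟦⟧≤1 (anyFin (H u)))) ⟩
  2 * (n * 1)       ≡⟨ cong (2 *_) (*-identityʳ n) ⟩
  2 * n             ∎
  where open ≤-Reasoning

-- Forest packings

module ForestPacking {n k} {X : UGraph n} {Fs : Fin k → UGraph n} (packing : IsForestPacking k X Fs) where

  private
    simple : ∀ i → IsSimple (Fs i)
    simple i = proj₁ (packing i)
    available : ∀ i {u v} → Adj (Fs i) u v → Adj (X ∖ᴳ unionBefore Fs i) u v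
    available i = proj₁ (proj₂ (packing i)) _ _
    acyclic : ∀ i → Acyclic (Fs i)
    acyclic i = proj₁ (proj₂ (proj₂ (packing i)))
    spanning : ∀ i {u v} → Reach (X ∖ᴳ unionBefore Fs i) u v → Reach (Fs i) u v
    spanning i = proj₂ (proj₂ (proj₂ (packing i))) _ _

  packing-⊆ : Subgraph (bigUnion Fs) X
  packing-⊆ u v inUnion with i , uv ← anyFin⇒∃ (λ i → Fs i u v) inUnion =
    ∖ᴳ-⊆ X (unionBefore Fs i) u v (available i uv)

  earlier-forest-avoids : ∀ {i j u v} → toℕ j < toℕ i → Adj (Fs i) u v → Fs j u v ≡ false
  earlier-forest-avoids {i} {j} {u} {v} j<i uv
    with unionBefore Fs i u v in before | ∧-conicalʳ (X u v) _ (available i uv)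
  ... | false | _ with toℕ j <ᵇ toℕ i | <⇒<ᵇ j<i | anyFin≡false⇒ before j
  ...   | true | _ | Fj-avoids = Fj-avoids

  packing-disjoint : ∀ {u v i j} → Adj (Fs i) u v → Adj (Fs j) u v → i ≡ j
  packing-disjoint {i = i} {j} ui uj with <-cmp (toℕ i) (toℕ j)
  ... | tri< i<j _ _ with () ← trans (sym ui) (earlier-forest-avoids i<j uj)
  ... | tri≈ _ i≡j _ = toℕ-injective i≡j
  ... | tri> _ _ j<i with () ← trans (sym uj) (earlier-forest-avoids j<i ui)

  packing-sumDeg≤ : sumDeg (bigUnion Fs) ≤ 2 * k * n
  packing-sumDeg≤ = begin
    sumDeg (bigUnion Fs)         ≤⟨ sumDeg-bigUnion Fs ⟩
    sumFin (λ i → sumDeg (Fs i)) ≤⟨ sumFin-≤-* (2 * n) (λ i → forest-sumDeg≤ (simple i) (acyclic i)) ⟩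
    k * (2 * n)                  ≡⟨ *-assoc k 2 n ⟨
    k * 2 * n                    ≡⟨ cong (_* n) (*-comm k 2) ⟩
    2 * k * n                    ∎
    where open ≤-Reasoning

  missing-crossing-edge⇒k≤cutG : ∀ {S : Fin n → Bool} {u v} → S u ≡ true → S v ≡ false →
    Adj X u v → bigUnion Fs u v ≡ false → k ≤ cutG (bigUnion Fs) S
  missing-crossing-edge⇒k≤cutG {S} {u} {v} Su Sv uv missing = begin
    k                            ≡⟨ *-identityʳ k ⟨
    k * 1                        ≤⟨ *-≤-sumFin 1 forest-crosses ⟩
    sumFin (λ i → cutG (Fs i) S) ≤⟨ cutG-bigUnion Fs S packing-disjoint ⟩
    cutG (bigUnion Fs) S         ∎
    where
    open ≤-Reasoning
    uv-available : ∀ i → Adj (X ∖ᴳ unionBefore Fs i) u v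
    uv-available i = cong₂ (λ x b → x ∧ not b) uv (not-before i)
      where
      not-before : ∀ i → unionBefore Fs i u v ≡ false
      not-before i = all-false⇒anyFin≡false λ j →
        trans (cong ((toℕ j <ᵇ toℕ i) ∧_) (anyFin≡false⇒ {f = λ j → Fs j u v} missing j)) (∧-zeroʳ _)
    forest-crosses : ∀ i → 1 ≤ cutG (Fs i) S
    forest-crosses i with a , b , Sa , Sb , ab ← reach⇒crossing-edge (spanning i (step (uv-available i) here)) Su Sv =
      crossing-edge⇒1≤cutG {H = Fs i} {S} Sa Sb ab

open ForestPacking

-- Minimum cuts

cutValue-cong : ∀ {n} (G : UGraph n) (F : WDigraph n) {S T : Fin n → Bool} →
  S ≗ T → cutValue G F S ≡ cutValue G F T
cutValue-cong G F S≗T = cong₂ _+_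
  (sumFin-cong λ u → sumFin-cong λ v → cong₂ (λ a b → ⟦ a ∧ not b ∧ G u v ⟧) (S≗T u) (S≗T v))
  (sumFin-cong λ u → sumFin-cong λ v → cong₂ (λ a b → if a ∧ not b then F u v else 0) (S≗T u) (S≗T v))

argmin : ∀ n (g : (Fin n → Bool) → ℕ) → (∀ {S T} → S ≗ T → g S ≡ g T) →
  ∃ λ S → ∀ T → g S ≤ g T
argmin zero g g-cong = (λ ()) , λ T → ≤-reflexive (g-cong λ ())
argmin (suc n) g g-cong = choose (≤-total (g (true ◃ S₁)) (g (false ◃ S₀)))
  where
  restricted : ∀ b → ∃ λ S → ∀ T → g (b ◃ S) ≤ g (b ◃ T)
  restricted b = argmin n (λ S → g (b ◃ S)) (λ S≗T → g-cong λ { zero → refl ; (suc i) → S≗T i })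
  S₁ = proj₁ (restricted true)
  S₀ = proj₁ (restricted false)
  head-tail : ∀ T → T ≗ (T zero ◃ (T ∘ suc))
  head-tail T zero = refl
  head-tail T (suc i) = refl
  by-head : ∀ T → g (true ◃ S₁) ≤ g T ⊎ g (false ◃ S₀) ≤ g T
  by-head T with T zero | g-cong (head-tail T)
  ... | true | T≡ = inj₁ (≤-trans (proj₂ (restricted true) (T ∘ suc)) (≤-reflexive (sym T≡)))
  ... | false | T≡ = inj₂ (≤-trans (proj₂ (restricted false) (T ∘ suc)) (≤-reflexive (sym T≡)))
  choose : g (true ◃ S₁) ≤ g (false ◃ S₀) ⊎ g (false ◃ S₀) ≤ g (true ◃ S₁) →
    ∃ λ S → ∀ T → g S ≤ g T
  choose (inj₁ t≤f) = true ◃ S₁ , λ T → [ id , ≤-trans t≤f ]′ (by-head T)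
  choose (inj₂ f≤t) = false ◃ S₀ , λ T → [ ≤-trans f≤t , id ]′ (by-head T)

pin : ∀ {n} → Fin n → Fin n → (Fin n → Bool) → Fin n → Bool
pin s t S i with i ≟ s | i ≟ t
... | yes _ | _ = true
... | no _ | yes _ = false
... | no _ | no _ = S i

pin-cong : ∀ {n} (s t : Fin n) {S T : Fin n → Bool} → S ≗ T → pin s t S ≗ pin s t T
pin-cong s t S≗T i with i ≟ s | i ≟ t
... | yes _ | _ = refl
... | no _ | yes _ = refl
... | no _ | no _ = S≗T i

pin-isSTCut : ∀ {n} {s t : Fin n} (S : Fin n → Bool) → s ≢ t → IsSTCut s t (pin s t S)
pin-isSTCut {s = s} {t} S s≢t = at-s , at-t
  where
  at-s : pin s t S s ≡ true
  at-s with s ≟ s | s ≟ t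
  ... | yes _ | _ = refl
  ... | no s≢s | _ = ⊥-elim (s≢s refl)
  at-t : pin s t S t ≡ false
  at-t with t ≟ s | t ≟ t
  ... | yes t≡s | _ = ⊥-elim (s≢t (sym t≡s))
  ... | no _ | yes _ = refl
  ... | no _ | no t≢t = ⊥-elim (t≢t refl)

pin-fixes : ∀ {n} {s t : Fin n} {S : Fin n → Bool} → IsSTCut s t S → pin s t S ≗ S
pin-fixes {s = s} {t} (Ss , St) i with i ≟ s | i ≟ t
... | yes refl | _ = sym Ss
... | no _ | yes refl = sym St
... | no _ | no _ = refl

minCut-exists : ∀ {n} (G : UGraph n) (F : WDigraph n) {s t : Fin n} → s ≢ t → ∃ (IsMinCut G F s t)
minCut-exists {n} G F {s} {t} s≢t
  with S , minimal ← argmin n (cutValue G F ∘ pin s t) (λ S≗T → cutValue-cong G F (pin-cong s t S≗T)) =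
  pin s t S , pin-isSTCut S s≢t ,
  λ T T-isSTCut → ≤-trans (minimal T) (≤-reflexive (cutValue-cong G F (pin-fixes T-isSTCut)))

Minimiser : ∀ {A : Set} → (A → Set) → (A → ℕ) → A → Set
Minimiser P f x = P x × (∀ y → P y → f x ≤ f y)

module MinimiserTransfer {A : Set} {P : A → Set} {f g : A → ℕ} {k : ℕ}
  (g≤f : ∀ x → g x ≤ f x) (f≤g⊎k≤g : ∀ x → f x ≤ g x ⊎ k ≤ g x) where

  g≡f-below : ∀ {x} → g x < k → g x ≡ f x
  g≡f-below {x} gx<k with f≤g⊎k≤g x
  ... | inj₁ f≤g = ≤-antisym (g≤f x) f≤g
  ... | inj₂ k≤g = ⊥-elim (<⇒≱ gx<k k≤g)

  f-minimiser⇒g-minimiser : ∀ {x} → f x < k → Minimiser P f x → Minimiser P g x × g x ≡ f x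
  f-minimiser⇒g-minimiser {x} fx<k (Px , f-minimal) = (Px , g-minimal) , gx≡fx
    where
    gx≡fx : g x ≡ f x
    gx≡fx = g≡f-below (≤-<-trans (g≤f x) fx<k)
    g-minimal : ∀ y → P y → g x ≤ g y
    g-minimal y Py with g y <? k
    ... | yes gy<k = ≤-trans (≤-reflexive gx≡fx) (≤-trans (f-minimal y Py) (≤-reflexive (sym (g≡f-below gy<k))))
    ... | no gy≮k = ≤-trans (g≤f x) (≤-trans (<⇒≤ fx<k) (≮⇒≥ gy≮k))

  g-minimiser⇒f-minimiser : ∀ {x₀ x} → P x₀ → f x₀ < k → Minimiser P g x → Minimiser P f x × f x ≡ g x
  g-minimiser⇒f-minimiser {x₀} {x} Px₀ fx₀<k (Px , g-minimal) = (Px , f-minimal) , sym gx≡fx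
    where
    gx≡fx : g x ≡ f x
    gx≡fx = g≡f-below (≤-<-trans (g-minimal x₀ Px₀) (≤-<-trans (g≤f x₀) fx₀<k))
    f-minimal : ∀ y → P y → f x ≤ f y
    f-minimal y Py = ≤-trans (≤-reflexive (sym gx≡fx)) (≤-trans (g-minimal y Py) (g≤f y))

module PackedMinCuts {n k} {GA GB : UGraph n} {PA PB : Fin k → UGraph n}
  (packA : IsForestPacking k GA PA) (packB : IsForestPacking k GB PB)
  (F : WDigraph n) {s t : Fin n} (s≢t : s ≢ t)
  (ν<k : ∀ v → IsMinCutValue (GA ∪ᴳ GB) F s t v → suc v ≤ k) where

  private
    G P : UGraph n
    G = GA ∪ᴳ GB
    P = bigUnion PA ∪ᴳ bigUnion PB

  P⊆G : Subgraph P G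
  P⊆G u v uv with ∨-true (bigUnion PA u v) uv
  ... | inj₁ inA rewrite packing-⊆ packA u v inA = refl
  ... | inj₂ inB rewrite packing-⊆ packB u v inB = ∨-zeroʳ (GA u v)

  cutG-dichotomy : ∀ S → cutG G S ≤ cutG P S ⊎ k ≤ cutG P S
  cutG-dichotomy S
    with any? (λ u → any? λ v → (S u ≟ᵇ true) ×-dec (S v ≟ᵇ false) ×-dec (G u v ≟ᵇ true) ×-dec (P u v ≟ᵇ false))
  ... | no none-missing = inj₁ (cutG-mono S kept)
    where
    kept : ∀ {u v} → S u ≡ true → S v ≡ false → Adj G u v → Adj P u v
    kept {u} {v} Su Sv uv with P u v in Puv
    ... | true = refl
    ... | false = ⊥-elim (none-missing (u , v , Su , Sv , uv , Puv))
  ... | yes (u , v , Su , Sv , uv , missing) with ∨-true (GA u v) uv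
  ...   | inj₁ inA = inj₂ (≤-trans (missing-crossing-edge⇒k≤cutG packA Su Sv inA (∨-conicalˡ _ _ missing))
                                   (cutG-mono-⊆ S (∪ᴳ-⊆ˡ (bigUnion PA) (bigUnion PB))))
  ...   | inj₂ inB = inj₂ (≤-trans (missing-crossing-edge⇒k≤cutG packB Su Sv inB (∨-conicalʳ _ _ missing))
                                   (cutG-mono-⊆ S (∪ᴳ-⊆ʳ (bigUnion PA) (bigUnion PB))))

  cutValue-P≤G : ∀ S → cutValue P F S ≤ cutValue G F S
  cutValue-P≤G S = +-monoˡ-≤ (cutF F S) (cutG-mono-⊆ S P⊆G)

  cutValue-dichotomy : ∀ S → cutValue G F S ≤ cutValue P F S ⊎ k ≤ cutValue P F S
  cutValue-dichotomy S with cutG-dichotomy S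
  ... | inj₁ G≤P = inj₁ (+-monoˡ-≤ (cutF F S) G≤P)
  ... | inj₂ k≤P = inj₂ (≤-trans k≤P (m≤m+n (cutG P S) (cutF F S)))

  open MinimiserTransfer {P = IsSTCut s t} cutValue-P≤G cutValue-dichotomy

  minCut-G⇒P : ∀ {S} → IsMinCut G F s t S → IsMinCut P F s t S × cutValue P F S ≡ cutValue G F S
  minCut-G⇒P {S} minCut = f-minimiser⇒g-minimiser (ν<k _ (S , minCut , refl)) minCut

  minCut-P⇒G : ∀ {S} → IsMinCut P F s t S → IsMinCut G F s t S × cutValue G F S ≡ cutValue P F S
  minCut-P⇒G with S₀ , minCut₀ ← minCut-exists G F s≢t =
    g-minimiser⇒f-minimiser (proj₁ minCut₀) (ν<k _ (S₀ , minCut₀ , refl))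

  minCut⇔ : ∀ S → IsMinCut G F s t S ⇔ IsMinCut P F s t S
  minCut⇔ S = mk⇔ (proj₁ ∘ minCut-G⇒P) (proj₁ ∘ minCut-P⇒G)

  minCutValue⇔ : ∀ v → IsMinCutValue G F s t v ⇔ IsMinCutValue P F s t v
  minCutValue⇔ v = mk⇔
    (λ (S , minCut , value) → let minCut′ , same = minCut-G⇒P {S} minCut in S , minCut′ , trans same value)
    (λ (S , minCut , value) → let minCut′ , same = minCut-P⇒G {S} minCut in S , minCut′ , trans same value)

mainTheorem15 : Σ ℕ (λ c →
    ∀ (n : ℕ) (GA GB : UGraph n) (F : WDigraph n) (s t : Fin n) →
    s ≢ t → IsSimple GA → IsSimple GB →
    (k : ℕ) →
    (∀ (v : ℕ) → IsMinCutValue (GA ∪ᴳ GB) F s t v → suc v ≤ k) →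
    (PA PB : Fin k → UGraph n) →
    IsForestPacking k GA PA → IsForestPacking k GB PB →
    ((sumDeg (bigUnion PA) ≤ c * k * n) × (sumDeg (bigUnion PB) ≤ c * k * n)) ×
    (∀ (v : ℕ) → IsMinCutValue (GA ∪ᴳ GB) F s t v ⇔ IsMinCutValue (bigUnion PA ∪ᴳ bigUnion PB) F s t v) ×
    (∀ (S : Fin n → Bool) → IsMinCut (GA ∪ᴳ GB) F s t S ⇔ IsMinCut (bigUnion PA ∪ᴳ bigUnion PB) F s t S))
mainTheorem15 = 2 , λ n GA GB F s t s≢t _ _ k ν<k PA PB packA packB →
  let open PackedMinCuts packA packB F s≢t ν<k in
  (packing-sumDeg≤ packA , packing-sumDeg≤ packB) , minCutValue⇔ , minCut⇔
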